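{- Let $\mathbb P,\mathbb Q,\mathbb R$ be arboreal forcings. (i) If $\mathbb P\sqsubset\mathbb Q$, $S\in\mathbb P$ and $T\in\mathbb Q$, then $[S]\cap[T]$ is meager in $[S]$; consequently $\mathbb P\cap\mathbb Q=\emptyset$ and $\mathbb Q$ is open dense in $\mathbb P\cup\mathbb Q$. (ii) If $\mathbb P\sqsubset\mathbb Q\sqsubset\mathbb R$ then $\mathbb P\sqsubset\mathbb R$; thus $\sqsubset$ is a strict partial order. (iii) If $\langle\mathbb P_\alpha:\alpha<\lambda\rangle$ is a $\sqsubset$-increasing sequence of arboreal forcings (i.e. $\mathbb P_\alpha\sqsubset\mathbb P_\beta$ whenever $\alpha<\beta<\lambda$) and $0<\mu<\lambda$, then $\bigcup_{\alpha<\mu}\mathbb P_\alpha\sqsubset\bigcup_{\mu\le\alpha<\lambda}\mathbb P_\alpha$. (iv) If $\langle\mathbb P_\alpha:\alpha<\lambda\rangle$ is a $\sqsubset$-increasing sequence of arboreal forcings and each $\mathbb P_\alpha$ is special, then $\mathbb P=\bigcup_{\alpha<\lambda}\mathbb P_\alpha$ is an arboreal forcing, $\mathbb P$ is regular, and each $\mathbb P_\gamma$ ($\gamma<\lambda$) is pre-dense in $\mathbb P$.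
   Context: $2^{<\omega}$ is the set of finite binary strings; a tree is a set $T\subseteq 2^{<\omega}$ closed under initial segments. $\mathbf{PT}$ is the set of perfect trees: nonempty trees with no endpoints and no isolated branches. For $T\in\mathbf{PT}$, $[T]=\{a\in 2^\omega:\forall n\,(a\restriction n\in T)\}$, and for $s\in T$, $T|s=\{t\in T: s\subseteq t\text{ or }t\subseteq s\}$. Trees $S,T$ are almost disjoint (a.d.) if $S\cap T$ is finite (equivalently $[S]\cap[T]=\emptyset$); an antichain is a set of pairwise a.d. trees. An arboreal forcing is a set $\mathbb P\subseteq\mathbf{PT}$ such that $T|u\in\mathbb P$ whenever $u\in T\in\mathbb P$; it is ordered by inclusion (smaller trees are stronger). $\mathbb P$ is regular if for all $S,T\in\mathbb P$ the set $[S]\cap[T]$ is clopen in $[S]$ or clopen in $[T]$; $\mathbb P$ is special if there is a finite or countable antichain $A\subseteq\mathbb P$ with $\mathbb P=\{T|s: s\in T\in A\}$. For arboreal forcings, $\mathbb P\sqsubset\mathbb Q$ ($\mathbb Q$ is a refinement of $\mathbb P$) means: (1) for every $T\in\mathbb P$ there is $Q\in\mathbb Q$ with $Q\subseteq T$; (2) every $Q\in\mathbb Q$ is covered by finitely many trees from $\mathbb P$, i.e. $Q\subseteq T_1\cup\dots\cup T_k$ for some $T_i\in\mathbb P$; (3) if $Q\in\mathbb Q$ and $T\in\mathbb P$ then $[Q]\cap[T]$ is clopen in $[Q]$ and $T\not\subseteq Q$. For $\mathbb P\subseteq\mathbb R\subseteq\mathbf{PT}$: $\mathbb P$ is dense in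 $\mathbb R$ if every $T\in\mathbb R$ contains some $S\in\mathbb P$; open dense if moreover $T\in\mathbb R$, $S\in\mathbb P$, $T\subseteq S$ imply $T\in\mathbb P$; pre-dense if $\{T\in\mathbb R:\exists S\in\mathbb P\,(T\subseteq S)\}$ is dense in $\mathbb R$. -}

module Defs where

open import Data.Bool using (Bool; true; false; _∧_; _∨_; _≟_)
open import Data.Nat using (ℕ; zero; suc)
open import Data.List using (List; []; _∷_; _++_; [_])
open import Data.List.Membership.Propositional using (_∈_)
open import Data.List.Relation.Unary.All using (All)
open import Data.List.Relation.Unary.Any using (Any)
open import Data.Product using (Σ; ∃; _×_; _,_)
open import Data.Sum using (_⊎_)
open import Data.Empty using (⊥)
open import Relation.Nullary using (¬_)
open import Relation.Binary.PropositionalEquality using (_≡_; _≢_)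
open import Function.Bundles using (_↣_; _⇔_)

Str : Set
Str = List Bool

Cantor : Set
Cantor = ℕ → Bool

_↾_ : Cantor → ℕ → Str
a ↾ zero  = []
a ↾ suc n = a 0 ∷ ((λ k → a (suc k)) ↾ n)

isPrefix : Str → Str → Bool
isPrefix []      t       = true
isPrefix (x ∷ s) []      = false
isPrefix (x ∷ s) (y ∷ t) = (x ≡ᵇ y) ∧ isPrefix s t
  where
  _≡ᵇ_ : Bool → Bool → Bool
  true  ≡ᵇ true  = true
  false ≡ᵇ false = true
  _     ≡ᵇ _     = false

_⊑_ : Str → Str → Set
s ⊑ t = isPrefix s t ≡ true

-- Sets of strings (in particular trees) as characteristic functions

Tree : Set
Tree = Str → Bool

_∈ₜ_ : Str → Tree → Set
s ∈ₜ T = T s ≡ true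

_⊆ₜ_ : Tree → Tree → Set
S ⊆ₜ T = ∀ s → s ∈ₜ S → s ∈ₜ T

_≐_ : Tree → Tree → Set
S ≐ T = ∀ s → S s ≡ T s

IsTree : Tree → Set
IsTree T = ∀ s t → s ⊑ t → t ∈ₜ T → s ∈ₜ T

body : Tree → Cantor → Set
body T a = ∀ n → (a ↾ n) ∈ₜ T

_∣_ : Tree → Str → Tree
(T ∣ s) t = T t ∧ (isPrefix s t ∨ isPrefix t s)

Perfect : Tree → Set
Perfect T =
  IsTree T
  × ([] ∈ₜ T)
  × (∀ s → s ∈ₜ T → Σ Bool λ b → (s ++ [ b ]) ∈ₜ T)
  × (∀ a → body T a → ∀ n →
       Σ Cantor λ c → body T c × (c ↾ n ≡ a ↾ n) × Σ ℕ λ k → c k ≢ a k)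

AlmostDisjoint : Tree → Tree → Set
AlmostDisjoint S T = Σ (List Str) λ L → ∀ s → s ∈ₜ S → s ∈ₜ T → s ∈ L

CSet : Set₁
CSet = Cantor → Set

_∩_ : CSet → CSet → CSet
(X ∩ Y) a = X a × Y a

OpenIn : CSet → CSet → Set
OpenIn X Y = ∀ a → Y a → Σ ℕ λ n → ∀ b → X b → b ↾ n ≡ a ↾ n → Y b

ClosedIn : CSet → CSet → Set
ClosedIn X Y = ∀ a → X a → ¬ Y a → Σ ℕ λ n → ∀ b → X b → b ↾ n ≡ a ↾ n → ¬ Y b

ClopenIn : CSet → CSet → Set
ClopenIn X Y = OpenIn X Y × ClosedIn X Y

NowhereDenseIn : CSet → CSet → Set
NowhereDenseIn X Y =
  ∀ a → X a → ∀ n →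
    Σ Cantor λ c → X c × (c ↾ n ≡ a ↾ n) ×
      Σ ℕ λ m → ∀ b → X b → b ↾ m ≡ c ↾ m → ¬ Y b

MeagerIn : CSet → CSet → Set₁
MeagerIn X Y =
  Σ (ℕ → CSet) λ F → (∀ k → NowhereDenseIn X (F k))
                   × (∀ a → Y a → Σ ℕ λ k → F k a)

-- Forcings (sets of trees, as predicates respecting ≐)

Forcing : Set₁
Forcing = Tree → Set

Arboreal : Forcing → Set
Arboreal P =
  (∀ T → P T → Perfect T)
  × (∀ S T → S ≐ T → P S → P T)
  × (∀ T u → P T → u ∈ₜ T → P (T ∣ u))

Regular : Forcing → Set
Regular P = ∀ S T → P S → P T →
  ClopenIn (body S) (body S ∩ body T) ⊎ ClopenIn (body T) (body S ∩ body T)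

-- P is special: P = { T|s : s ∈ T ∈ A } for a finite or countable antichain A ⊆ P
-- (A is indexed injectively by a set J with an injection into ℕ)
Special : Forcing → Set₁
Special P =
  Σ Set λ J → (J ↣ ℕ) × Σ (J → Tree) λ A →
    (∀ j → Perfect (A j))
    × (∀ i j → i ≢ j → AlmostDisjoint (A i) (A j))
    × (∀ T → P T ⇔ (Σ J λ j → Σ Str λ s → s ∈ₜ A j × T ≐ (A j ∣ s)))

_⊏_ : Forcing → Forcing → Set
P ⊏ Q =
  (∀ T → P T → Σ Tree λ R → Q R × R ⊆ₜ T)
  × (∀ R → Q R → Σ (List Tree) λ Ts → All P Ts × (∀ s → s ∈ₜ R → Any (λ T → s ∈ₜ T) Ts))
  × (∀ R T → Q R → P T →
       ClopenIn (body R) (body R ∩ body T) × ¬ (T ⊆ₜ R))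

_∪_ : Forcing → Forcing → Forcing
(P ∪ Q) T = P T ⊎ Q T

DenseIn : Forcing → Forcing → Set
DenseIn P R = ∀ T → R T → Σ Tree λ S → P S × S ⊆ₜ T

OpenDenseIn : Forcing → Forcing → Set
OpenDenseIn P R = DenseIn P R × (∀ T S → R T → P S → T ⊆ₜ S → P T)

PreDenseIn : Forcing → Forcing → Set
PreDenseIn P R = DenseIn (λ T → R T × Σ Tree λ S → P S × T ⊆ₜ S) R

-- Index "ordinal" λ: a type with a strict well-order

record WellOrder : Set₁ where
  field
    Idx  : Set
    _<_  : Idx → Idx → Set
    trans : ∀ {a b c} → a < b → b < c → a < c
    irrefl : ∀ {a} → ¬ (a < a)
    tri  : ∀ a b → a < b ⊎ a ≡ b ⊎ b < a
    wf   : ∀ (Q : Idx → Set) → (∀ a → (∀ b → b < a → Q b) → Q a) → ∀ a → Q a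

Increasing : (W : WellOrder) → (WellOrder.Idx W → Forcing) → Set
Increasing W Ps = ∀ α β → α < β → Ps α ⊏ Ps β
  where open WellOrder W

-- The cones T ∣ u are the basic open sets of [T], and (classically) a point outside [T]
-- leaves T at a finite level. If ℙ ⊏ ℚ, S ∈ ℙ and T ∈ ℚ, a cone of S with body inside [T]
-- would be a ℙ-tree contained in T, so [S] ∩ [T] is nowhere dense in [S]. Iterating, every
-- ℙ-tree has a branch avoiding any finitely many ℚ-trees; since an ℝ-tree is covered by
-- finitely many ℚ-trees, this and the relative openness of [T] in each of them give ℙ ⊏ ℝ.
-- Along a ⊏-chain, trees from different levels are separated by the same clause (3), and
-- trees from one special level are cones of one antichain member or have disjoint bodies.

module Submission where

open import Defs
open import Level using (0ℓ)
open import Axiom.ExcludedMiddle using (ExcludedMiddle)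
open import Axiom.DoubleNegationElimination using (em⇒dne)
open import Data.Bool using (Bool; true; false; _∧_; _∨_)
open import Data.Bool.Properties using (∧-conicalˡ; ∧-conicalʳ; ∨-zeroʳ)
open import Data.Nat using (ℕ; zero; suc; pred; _+_; _≤_; z≤n; s≤s; _⊔_)
open import Data.Nat.Properties using (≤-refl; ≤-trans; ≤-total; m≤n+m; m≤m⊔n; m≤n⊔m; n≮n)
open import Data.List using (List; []; _∷_; _++_; [_]; length; map)
open import Data.List.Properties using (∷-injective; ++-assoc; ++-identityʳ)
open import Data.List.Extrema.Nat using (max; xs≤max)
open import Data.List.Relation.Unary.All as All using (All; []; _∷_)
open import Data.List.Relation.Unary.All.Properties using (map⁻; ++⁺; ¬Any⇒All¬; All¬⇒¬Any)
open import Data.List.Relation.Unary.Any as Any using (Any; here; there)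
open import Data.List.Relation.Unary.Any.Properties using (++⁺ˡ; ++⁺ʳ)
open import Data.Product using (Σ; _×_; _,_; proj₁; proj₂; swap)
open import Data.Sum using (_⊎_; inj₁; inj₂)
open import Data.Empty using (⊥; ⊥-elim)
open import Relation.Nullary using (¬_; yes; no)
open import Relation.Binary.PropositionalEquality using (_≡_; refl; sym; trans; cong; cong₂; subst)
open import Function.Base using (_∘_)
open import Function.Bundles using (Equivalence)

private
  variable
    a b c : Cantor
    m n : ℕ
    t : Str
    R S T : Tree
    Ts : List Tree
    ℙ ℚ ℝ : Forcing

⊑-cons : ∀ x u t → u ⊑ t → (x ∷ u) ⊑ (x ∷ t)
⊑-cons true  _ _ u⊑t = u⊑t
⊑-cons false _ _ u⊑t = u⊑t

⊑-uncons : ∀ x y u t → (x ∷ u) ⊑ (y ∷ t) → x ≡ y × u ⊑ t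
⊑-uncons true  true  _ _ u⊑t = refl , u⊑t
⊑-uncons false false _ _ u⊑t = refl , u⊑t

⊑∧length≡⇒≡ : ∀ u t → u ⊑ t → length u ≡ length t → u ≡ t
⊑∧length≡⇒≡ []      []      _ _ = refl
⊑∧length≡⇒≡ (x ∷ u) (y ∷ t) p len with ⊑-uncons x y u t p
... | refl , u⊑t = cong (x ∷_) (⊑∧length≡⇒≡ u t u⊑t (cong pred len))

length-↾ : ∀ a n → length (a ↾ n) ≡ n
length-↾ a zero    = refl
length-↾ a (suc n) = cong suc (length-↾ (λ k → a (suc k)) n)

↾-⊑ : ∀ a → n ≤ m → (a ↾ n) ⊑ (a ↾ m)
↾-⊑ a z≤n       = refl
↾-⊑ a (s≤s {n} {m} n≤m) = ⊑-cons (a 0) (a′ ↾ n) (a′ ↾ m) (↾-⊑ a′ n≤m)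
  where a′ = λ k → a (suc k)

↾≡-downward : n ≤ m → b ↾ m ≡ a ↾ m → b ↾ n ≡ a ↾ n
↾≡-downward z≤n _ = refl
↾≡-downward {b = b} {a = a} (s≤s n≤m) eq with ∷-injective eq
... | b₀≡a₀ , tail≡ = cong₂ _∷_ b₀≡a₀ (↾≡-downward {b = λ k → b (suc k)} {λ k → a (suc k)} n≤m tail≡)

↾∉⇒¬body : ∀ T a n → ¬ (a ↾ n) ∈ₜ T → ∀ b → b ↾ n ≡ a ↾ n → ¬ body T b
↾∉⇒¬body T a n a↾n∉T b eq bT = a↾n∉T (subst (_∈ₜ T) eq (bT _))

↾∉-upward : ∀ T a → IsTree T → ¬ (a ↾ n) ∈ₜ T → n ≤ m → ¬ (a ↾ m) ∈ₜ T
↾∉-upward T a isTree a↾n∉T n≤m a↾m∈T = a↾n∉T (isTree _ _ (↾-⊑ a n≤m) a↾m∈T)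

_∷ᶜ_ : Bool → Cantor → Cantor
(x ∷ᶜ d) zero    = x
(x ∷ᶜ d) (suc i) = d i

_++ᶜ_ : Str → Cantor → Cantor
[]      ++ᶜ d = d
(x ∷ t) ++ᶜ d = x ∷ᶜ (t ++ᶜ d)

↾-++ᶜ : ∀ t d n → (t ++ᶜ d) ↾ (length t + n) ≡ t ++ (d ↾ n)
↾-++ᶜ []      d n = refl
↾-++ᶜ (x ∷ t) d n = cong (x ∷_) (↾-++ᶜ t d n)

↾-++ᶜ-length : ∀ t d → (t ++ᶜ d) ↾ length t ≡ t
↾-++ᶜ-length []      d = refl
↾-++ᶜ-length (x ∷ t) d = cong (x ∷_) (↾-++ᶜ-length t d)

NoEndpoints : Tree → Set
NoEndpoints T = ∀ s → s ∈ₜ T → Σ Bool λ b → (s ++ [ b ]) ∈ₜ T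

_/_ : Tree → Str → Tree
(T / u) s = T (u ++ s)

/-noEndpoints : ∀ u → NoEndpoints T → NoEndpoints (T / u)
/-noEndpoints {T} u ext s s∈T/u with ext (u ++ s) s∈T/u
... | b , sb∈T/u = b , subst (_∈ₜ T) (++-assoc u s [ b ]) sb∈T/u

rootBranch : ∀ T → NoEndpoints T → [] ∈ₜ T → Cantor
rootBranch T ext root zero    = proj₁ (ext [] root)
rootBranch T ext root (suc i) =
  rootBranch (T / [ b₀ ]) (/-noEndpoints [ b₀ ] ext) (proj₂ (ext [] root)) i
  where b₀ = proj₁ (ext [] root)

rootBranch-body : ∀ T ext root → body T (rootBranch T ext root)
rootBranch-body T ext root zero    = root
rootBranch-body T ext root (suc n) =
  rootBranch-body (T / [ b₀ ]) (/-noEndpoints [ b₀ ] ext) (proj₂ (ext [] root)) n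
  where b₀ = proj₁ (ext [] root)

branch-through : Perfect T → t ∈ₜ T → Σ Cantor λ c → body T c × c ↾ length t ≡ t
branch-through {T} {t} (isTree , _ , ext , _) t∈T = t ++ᶜ d , c∈T , ↾-++ᶜ-length t d
  where
  d : Cantor
  d = rootBranch (T / t) (/-noEndpoints t ext) (subst (_∈ₜ T) (sym (++-identityʳ t)) t∈T)
  c∈T : body T (t ++ᶜ d)
  c∈T n = isTree _ _ (↾-⊑ (t ++ᶜ d) (m≤n+m n (length t)))
            (subst (_∈ₜ T) (sym (↾-++ᶜ t d n)) (rootBranch-body (T / t) _ _ n))

branch : Perfect T → Σ Cantor (body T)
branch perfT@(_ , root , _) with branch-through perfT root
... | c , c∈T , _ = c , c∈T

body⊆⇒⊆ : Perfect S → (∀ c → body S c → body T c) → S ⊆ₜ T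
body⊆⇒⊆ {T = T} perfS sub t t∈S with branch-through perfS t∈S
... | c , c∈S , c↾≡t = subst (_∈ₜ T) c↾≡t (sub c c∈S (length t))

body-∣⁻ : ∀ A u c → body (A ∣ u) c → body A c
body-∣⁻ A u c c∈ n = ∧-conicalˡ (A (c ↾ n)) _ (c∈ n)

body-∣-stem : ∀ A u c → body (A ∣ u) c → c ↾ length u ≡ u
body-∣-stem A u c c∈ with ∨-true (∧-conicalʳ (A (c ↾ length u)) _ (c∈ (length u)))
  where
  ∨-true : ∀ {x y} → x ∨ y ≡ true → x ≡ true ⊎ y ≡ true
  ∨-true {true}  _ = inj₁ refl
  ∨-true {false} p = inj₂ p
... | inj₁ u⊑c↾ = sym (⊑∧length≡⇒≡ u _ u⊑c↾ (sym (length-↾ c (length u))))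
... | inj₂ c↾⊑u = ⊑∧length≡⇒≡ _ u c↾⊑u (length-↾ c (length u))

body-∣⁺ : ∀ A u c → body A c → c ↾ length u ≡ u → body (A ∣ u) c
body-∣⁺ A u c c∈A stem n = ∧-intro (c∈A n) comparable
  where
  ∧-intro : ∀ {x y} → x ≡ true → y ≡ true → x ∧ y ≡ true
  ∧-intro refl q = q
  comparable : (isPrefix u (c ↾ n) ∨ isPrefix (c ↾ n) u) ≡ true
  comparable with ≤-total n (length u)
  ... | inj₁ n≤ = subst (λ y → isPrefix u (c ↾ n) ∨ y ≡ true)
                    (sym (subst ((c ↾ n) ⊑_) stem (↾-⊑ c n≤))) (∨-zeroʳ _)
  ... | inj₂ ≤n rewrite subst (_⊑ (c ↾ n)) stem (↾-⊑ c ≤n) = refl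

body-∣↾ : ∀ A a n c → body (A ∣ (a ↾ n)) c → c ↾ n ≡ a ↾ n
body-∣↾ A a n c c∈ = trans (cong (c ↾_) (sym (length-↾ a n))) (body-∣-stem A (a ↾ n) c c∈)

AlmostDisjoint⇒disjoint-bodies : AlmostDisjoint S T → body S a → body T a → ⊥
AlmostDisjoint⇒disjoint-bodies {a = a} (L , finite) a∈S a∈T =
  n≮n M (subst (_≤ M) (length-↾ a (suc M)) bounded)
  where
  M : ℕ
  M = max 0 (map length L)
  bounded : length (a ↾ suc M) ≤ M
  bounded = All.lookup (map⁻ (xs≤max 0 (map length L))) (finite (a ↾ suc M) (a∈S _) (a∈T _))

Eventually : (ℕ → Set) → Set
Eventually G = Σ ℕ λ n → ∀ m → n ≤ m → G m

All-eventually : ∀ {X : Set} {G : ℕ → X → Set} {xs} →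
                 All (λ x → Eventually (λ n → G n x)) xs → Eventually (λ n → All (G n) xs)
All-eventually [] = 0 , λ _ _ → []
All-eventually ((n₁ , g) ∷ gs) with All-eventually gs
... | n₂ , gs′ = n₁ ⊔ n₂ , λ m n≤m → g m (≤-trans (m≤m⊔n n₁ n₂) n≤m)
                                   ∷ gs′ m (≤-trans (m≤n⊔m n₁ n₂) n≤m)

FinitelyCovered : Forcing → Tree → Set
FinitelyCovered ℙ R = Σ (List Tree) λ Ts → All ℙ Ts × (∀ s → s ∈ₜ R → Any (s ∈ₜ_) Ts)

covered-trans : (∀ R → ℚ R → FinitelyCovered ℙ R) → FinitelyCovered ℚ R → FinitelyCovered ℙ R
covered-trans {ℚ} {ℙ} cover (Rs , Rs∈ℚ , R⊆Rs) =
  let Ts , Ts∈ℙ , Rs⊆Ts = union Rs∈ℚ in Ts , Ts∈ℙ , λ s s∈R → Rs⊆Ts s (R⊆Rs s s∈R)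
  where
  union : ∀ {Rs} → All ℚ Rs →
          Σ (List Tree) λ Ts → All ℙ Ts × (∀ s → Any (s ∈ₜ_) Rs → Any (s ∈ₜ_) Ts)
  union [] = [] , [] , λ _ ()
  union (q ∷ qs) with cover _ q | union qs
  ... | Ts₁ , p₁ , f₁ | Ts₂ , p₂ , f₂ =
    Ts₁ ++ Ts₂ , ++⁺ p₁ p₂ , λ { s (here s∈) → ++⁺ˡ (f₁ s s∈) ; s (there s∈) → ++⁺ʳ Ts₁ (f₂ s s∈) }

body-≐ : S ≐ T → body S a → body T a
body-≐ S≐T a∈S n = trans (sym (S≐T _)) (a∈S n)

ClopenIn-∩-comm : ∀ X Y Z → ClopenIn X (Y ∩ Z) → ClopenIn X (Z ∩ Y)
ClopenIn-∩-comm X Y Z (isOpen , isClosed) =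
    (λ a a∈Z∩Y → let n , near = isOpen a (swap a∈Z∩Y) in n , λ b b∈X b↾≡ → swap (near b b∈X b↾≡))
  , (λ a a∈X a∉ → let n , near = isClosed a a∈X (a∉ ∘ swap) in n , λ b b∈X b↾≡ → near b b∈X b↾≡ ∘ swap)

Arboreal⇒trees : Arboreal ℙ → All ℙ Ts → All IsTree Ts
Arboreal⇒trees (perfect , _) = All.map (λ {T} T∈ℙ → proj₁ (perfect T T∈ℙ))

⊏-clopen : ℙ ⊏ ℚ → ∀ R T → ℚ R → ℙ T → ClopenIn (body R) (body R ∩ body T)
⊏-clopen (_ , _ , separated) R T R∈ℚ T∈ℙ = proj₁ (separated R T R∈ℚ T∈ℙ)

⊏-disjoint : ℙ ⊏ ℚ → ℙ T → ℚ T → ⊥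
⊏-disjoint {T = T} (_ , _ , separated) T∈ℙ T∈ℚ = proj₂ (separated T T T∈ℚ T∈ℙ) (λ _ s∈T → s∈T)

⊏-openDense : ℙ ⊏ ℚ → OpenDenseIn ℚ (ℙ ∪ ℚ)
⊏-openDense {ℙ} {ℚ} (shrink , _ , separated) = dense , isOpen
  where
  dense : DenseIn ℚ (ℙ ∪ ℚ)
  dense T (inj₁ T∈ℙ) = shrink T T∈ℙ
  dense T (inj₂ T∈ℚ) = T , T∈ℚ , λ _ s∈T → s∈T
  isOpen : ∀ T S → (ℙ ∪ ℚ) T → ℚ S → T ⊆ₜ S → ℚ T
  isOpen T S (inj₁ T∈ℙ) S∈ℚ T⊆S = ⊥-elim (proj₂ (separated S T S∈ℚ T∈ℙ) T⊆S)
  isOpen T S (inj₂ T∈ℚ) _   _   = T∈ℚ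

module Chain (W : WellOrder) (Ps : WellOrder.Idx W → Forcing) where
  open WellOrder W using (Idx; _<_) renaming (trans to <-trans)

  ⋃ : Forcing
  ⋃ T = Σ Idx λ α → Ps α T

  ⋃< : Idx → Forcing
  ⋃< μ T = Σ Idx λ α → α < μ × Ps α T

  ⋃≥ : Idx → Forcing
  ⋃≥ μ T = Σ Idx λ α → (μ ≡ α ⊎ μ < α) × Ps α T

  ⋃-arboreal : (∀ α → Arboreal (Ps α)) → Arboreal ⋃
  ⋃-arboreal arb =
      (λ T (α , T∈) → proj₁ (arb α) T T∈)
    , (λ S T S≐T (α , S∈) → α , proj₁ (proj₂ (arb α)) S T S≐T S∈)
    , (λ T u (α , T∈) u∈T → α , proj₂ (proj₂ (arb α)) T u T∈ u∈T)

  ⊏-⋃<-⋃≥ : Increasing W Ps → ∀ {α₀ μ} → α₀ < μ → ⋃< μ ⊏ ⋃≥ μ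
  ⊏-⋃<-⋃≥ inc {α₀} {μ} α₀<μ = shrink , cover , separated
    where
    below<above : ∀ {α β} → α < μ → μ ≡ β ⊎ μ < β → α < β
    below<above α<μ (inj₁ refl) = α<μ
    below<above α<μ (inj₂ μ<β)  = <-trans α<μ μ<β
    shrink : ∀ T → ⋃< μ T → Σ Tree λ R → ⋃≥ μ R × R ⊆ₜ T
    shrink T (α , α<μ , T∈) =
      let R , R∈ , R⊆T = proj₁ (inc α μ α<μ) T T∈ in R , (μ , inj₁ refl , R∈) , R⊆T
    -- The level α₀ < μ (which exists as μ > 0) alone supplies all the covering trees.
    cover : ∀ R → ⋃≥ μ R → FinitelyCovered (⋃< μ) R
    cover R (β , μ≤β , R∈) =
      let Ts , Ts∈ , R⊆Ts = proj₁ (proj₂ (inc α₀ β (below<above α₀<μ μ≤β))) R R∈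
      in Ts , All.map (λ T∈ → α₀ , α₀<μ , T∈) Ts∈ , R⊆Ts
    separated : ∀ R T → ⋃≥ μ R → ⋃< μ T → ClopenIn (body R) (body R ∩ body T) × ¬ (T ⊆ₜ R)
    separated R T (β , μ≤β , R∈) (α , α<μ , T∈) =
      proj₂ (proj₂ (inc α β (below<above α<μ μ≤β))) R T R∈ T∈

module Classical (em : ExcludedMiddle 0ℓ) where

  dne : ∀ {X : Set} → ¬ ¬ X → X
  dne = em⇒dne em

  ¬body⇒exit : ∀ T a → ¬ body T a → Σ ℕ λ n → ¬ (a ↾ n) ∈ₜ T
  ¬body⇒exit T a a∉T = dne λ stays → a∉T λ n → dne λ a↾n∉T → stays (n , a↾n∉T)

  body∩-closedIn : ∀ R T → ClosedIn (body R) (body R ∩ body T)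
  body∩-closedIn R T a a∈R a∉R∩T =
    let n , a↾n∉T = ¬body⇒exit T a (λ a∈T → a∉R∩T (a∈R , a∈T))
    in n , λ b _ b↾n≡ (_ , b∈T) → ↾∉⇒¬body T a n a↾n∉T b b↾n≡ b∈T

  -- A branch leaving each of finitely many trees leaves all of them at a common level.
  body-covered : All IsTree Ts → (∀ s → s ∈ₜ R → Any (s ∈ₜ_) Ts) →
                 body R a → Any (λ T → body T a) Ts
  body-covered {Ts} {a = a} trees R⊆Ts a∈R = dne λ none →
    let N , exited = All-eventually (All.zipWith exits (trees , ¬Any⇒All¬ Ts none))
    in All¬⇒¬Any (exited N ≤-refl) (R⊆Ts _ (a∈R N))
    where
    exits : ∀ {T} → IsTree T × ¬ body T a → Eventually (λ n → ¬ (a ↾ n) ∈ₜ T)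
    exits {T} (isTree , a∉T) =
      let n , a↾n∉T = ¬body⇒exit T a a∉T in n , λ _ n≤m → ↾∉-upward T a isTree a↾n∉T n≤m

  openIn-covered : ∀ {X Y : CSet} → All (λ T → OpenIn (body T) (body T ∩ Y)) Ts →
                   (∀ b → X b → Any (λ T → body T b) Ts) → OpenIn X (X ∩ Y)
  openIn-covered {Y = Y} opens cover a (a∈X , a∈Y) =
    let N , near = All-eventually (All.map (λ {T} → nearby T) opens)
    in N , λ b b∈X b↾N≡ → b∈X , (let nearT , b∈T = All.lookupAny (near N ≤-refl) (cover b b∈X)
                                 in nearT b b↾N≡ b∈T)
    where
    nearby : ∀ T → OpenIn (body T) (body T ∩ Y) →
             Eventually (λ n → ∀ b → b ↾ n ≡ a ↾ n → body T b → Y b)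
    nearby T isOpen with em {body T a}
    ... | yes a∈T = let n , near = isOpen a (a∈T , a∈Y) in
      n , λ _ n≤m b b↾m≡ b∈T → proj₂ (near b b∈T (↾≡-downward n≤m b↾m≡))
    ... | no a∉T = let n , a↾n∉T = ¬body⇒exit T a a∉T in
      n , λ _ n≤m b b↾m≡ b∈T → ⊥-elim (↾∉⇒¬body T a n a↾n∉T b (↾≡-downward n≤m b↾m≡) b∈T)

  ⊏-nowhereDense : Arboreal ℙ → ℙ ⊏ ℚ → ℙ S → ℚ T → NowhereDenseIn (body S) (body S ∩ body T)
  ⊏-nowhereDense {ℙ} {S = S} {T} (perfect , _ , restrict) (_ , _ , separated) S∈ℙ T∈ℚ a a∈S n
    with em {Σ Cantor λ c → body (S ∣ (a ↾ n)) c × ¬ body T c}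
  ... | yes (c , c∈cone , c∉T) =
    let m , c↾m∉T = ¬body⇒exit T c c∉T
    in c , body-∣⁻ S (a ↾ n) c c∈cone , body-∣↾ S a n c c∈cone
         , m , λ b _ b↾m≡ (_ , b∈T) → ↾∉⇒¬body T c m c↾m∉T b b↾m≡ b∈T
  ... | no cone⊆T =
    ⊥-elim (proj₂ (separated T (S ∣ (a ↾ n)) T∈ℚ cone∈ℙ)
                  (body⊆⇒⊆ (perfect _ cone∈ℙ) λ c c∈cone → dne λ c∉T → cone⊆T (c , c∈cone , c∉T)))
    where
    cone∈ℙ : ℙ (S ∣ (a ↾ n))
    cone∈ℙ = restrict S (a ↾ n) S∈ℙ (a∈S n)

  ⊏-meager : Arboreal ℙ → ℙ ⊏ ℚ → ℙ S → ℚ T → MeagerIn (body S) (body S ∩ body T)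
  ⊏-meager {S = S} {T} aℙ ℙ⊏ℚ S∈ℙ T∈ℚ =
    (λ _ → body S ∩ body T) , (λ _ → ⊏-nowhereDense aℙ ℙ⊏ℚ S∈ℙ T∈ℚ) , λ _ a∈ → 0 , a∈

  ⊏-avoid : Arboreal ℙ → ℙ ⊏ ℚ → ∀ {Rs} → All ℚ Rs → ℙ T →
            Σ Cantor λ c → body T c × ¬ Any (λ R → body R c) Rs
  ⊏-avoid (perfect , _) _ [] T∈ℙ = let c , c∈T = branch (perfect _ T∈ℙ) in c , c∈T , λ ()
  ⊏-avoid {T = T} aℙ@(perfect , _ , restrict) ℙ⊏ℚ (R∈ℚ ∷ Rs∈ℚ) T∈ℙ =
    let a , a∈T = branch (perfect T T∈ℙ)
        c₀ , c₀∈T , _ , m , cylinder∉R = ⊏-nowhereDense aℙ ℙ⊏ℚ T∈ℙ R∈ℚ a a∈T 0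
        c , c∈cone , c∉Rs = ⊏-avoid aℙ ℙ⊏ℚ Rs∈ℚ (restrict T (c₀ ↾ m) T∈ℙ (c₀∈T m))
        c∈T = body-∣⁻ T (c₀ ↾ m) c c∈cone
    in c , c∈T , λ { (here c∈R)   → cylinder∉R c c∈T (body-∣↾ T c₀ m c c∈cone) (c∈T , c∈R)
                   ; (there c∈Rs) → c∉Rs c∈Rs }

  ⊏-trans : Arboreal ℙ → Arboreal ℚ → ℙ ⊏ ℚ → ℚ ⊏ ℝ → ℙ ⊏ ℝ
  ⊏-trans {ℙ} {ℚ} {ℝ} aℙ aℚ ℙ⊏ℚ@(shrinkℙ , coverℙ , _) (shrinkℚ , coverℚ , _) =
    shrink , (λ R R∈ℝ → covered-trans coverℙ (coverℚ R R∈ℝ)) , separated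
    where
    shrink : ∀ T → ℙ T → Σ Tree λ R → ℝ R × R ⊆ₜ T
    shrink T T∈ℙ =
      let Q , Q∈ℚ , Q⊆T = shrinkℙ T T∈ℙ
          R , R∈ℝ , R⊆Q = shrinkℚ Q Q∈ℚ
      in R , R∈ℝ , λ s s∈R → Q⊆T s (R⊆Q s s∈R)
    separated : ∀ R T → ℝ R → ℙ T → ClopenIn (body R) (body R ∩ body T) × ¬ (T ⊆ₜ R)
    separated R T R∈ℝ T∈ℙ with coverℚ R R∈ℝ
    ... | Qs , Qs∈ℚ , R⊆Qs = (isOpen , body∩-closedIn R T) , T⊈R
      where
      trees : All IsTree Qs
      trees = Arboreal⇒trees aℚ Qs∈ℚ
      isOpen : OpenIn (body R) (body R ∩ body T)
      isOpen = openIn-covered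
        (All.map (λ {Q} Q∈ℚ → proj₁ (⊏-clopen ℙ⊏ℚ Q T Q∈ℚ T∈ℙ)) Qs∈ℚ)
        (λ _ → body-covered trees R⊆Qs)
      T⊈R : ¬ (T ⊆ₜ R)
      T⊈R T⊆R =
        let c , c∈T , c∉Qs = ⊏-avoid aℙ ℙ⊏ℚ Qs∈ℚ T∈ℙ
        in c∉Qs (body-covered trees R⊆Qs λ n → T⊆R _ (c∈T n))

  ⊏-cone⊆ : Arboreal ℙ → Arboreal ℚ → ℙ ⊏ ℚ → ℚ T →
            Σ Str λ u → u ∈ₜ T × Σ Tree λ S → ℙ S × (T ∣ u) ⊆ₜ S
  ⊏-cone⊆ {T = T} aℙ (perfect , _ , restrict) ℙ⊏ℚ@(_ , coverℙ , _) T∈ℚ with coverℙ T T∈ℚ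
  ... | Ss , Ss∈ℙ , T⊆Ss =
    let a , a∈T = branch (perfect T T∈ℚ)
        i = body-covered (Arboreal⇒trees aℙ Ss∈ℙ) T⊆Ss a∈T
        S = Any.lookup i
        S∈ℙ , a∈S = All.lookupAny Ss∈ℙ i
        n , near = proj₁ (⊏-clopen ℙ⊏ℚ T S T∈ℚ S∈ℙ) a (a∈T , a∈S)
    in a ↾ n , a∈T n , S , S∈ℙ
     , body⊆⇒⊆ (perfect _ (restrict T (a ↾ n) T∈ℚ (a∈T n)))
         λ c c∈cone → proj₂ (near c (body-∣⁻ T (a ↾ n) c c∈cone) (body-∣↾ T a n c c∈cone))

  special-clopen : Special ℙ → ℙ S → ℙ T → ClopenIn (body S) (body S ∩ body T)
  special-clopen {ℙ} {S} {T} (J , _ , A , _ , almostDisjoint , ℙ⇔cones) S∈ℙ T∈ℙ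
    with Equivalence.to (ℙ⇔cones S) S∈ℙ | Equivalence.to (ℙ⇔cones T) T∈ℙ
  ... | j , s , _ , S≐ | k , t , _ , T≐ = isOpen , body∩-closedIn S T
    where
    isOpen : OpenIn (body S) (body S ∩ body T)
    isOpen a (a∈S , a∈T) with em {j ≡ k}
    ... | no j≢k = ⊥-elim (AlmostDisjoint⇒disjoint-bodies (almostDisjoint j k j≢k)
                             (body-∣⁻ (A j) s a (body-≐ S≐ a∈S)) (body-∣⁻ (A k) t a (body-≐ T≐ a∈T)))
    ... | yes refl = length t , λ b b∈S b↾≡ → b∈S ,
      body-≐ {S = A j ∣ t} (λ x → sym (T≐ x))
        (body-∣⁺ (A j) t b (body-∣⁻ (A j) s b (body-≐ S≐ b∈S)) (trans b↾≡ (body-∣-stem (A j) t a (body-≐ T≐ a∈T))))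

  module _ (W : WellOrder) (Ps : WellOrder.Idx W → Forcing) where
    open WellOrder W using (tri)
    open Chain W Ps using (⋃)

    ⋃-regular : Increasing W Ps → (∀ α → Special (Ps α)) → Regular ⋃
    ⋃-regular inc special S T (α , S∈) (β , T∈) with tri α β
    ... | inj₁ α<β =
      inj₂ (ClopenIn-∩-comm (body T) (body T) (body S) (⊏-clopen (inc α β α<β) T S T∈ S∈))
    ... | inj₂ (inj₁ refl) = inj₁ (special-clopen (special α) S∈ T∈)
    ... | inj₂ (inj₂ β<α) = inj₁ (⊏-clopen (inc β α β<α) S T S∈ T∈)

    ⋃-preDense : (∀ α → Arboreal (Ps α)) → Increasing W Ps → ∀ γ → PreDenseIn (Ps γ) ⋃
    ⋃-preDense arb inc γ T (α , T∈) with tri α γ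
    ... | inj₁ α<γ =
      let R , R∈ , R⊆T = proj₁ (inc α γ α<γ) T T∈ in R , ((γ , R∈) , R , R∈ , λ _ s∈ → s∈) , R⊆T
    ... | inj₂ (inj₁ refl) = T , ((α , T∈) , T , T∈ , λ _ s∈ → s∈) , λ _ s∈ → s∈
    ... | inj₂ (inj₂ γ<α) =
      let u , u∈T , S , S∈ , cone⊆S = ⊏-cone⊆ (arb γ) (arb α) (inc γ α γ<α) T∈
      in T ∣ u , ((α , proj₂ (proj₂ (arb α)) T u T∈ u∈T) , S , S∈ , cone⊆S)
       , λ s s∈cone → ∧-conicalˡ (T s) _ s∈cone

lemma5p2 : ExcludedMiddle 0ℓ →
    -- (i)
    (∀ (P Q : Forcing) → Arboreal P → Arboreal Q → P ⊏ Q →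
       (∀ S T → P S → Q T → MeagerIn (body S) (body S ∩ body T))
       × (∀ T → P T → Q T → ⊥)
       × OpenDenseIn Q (P ∪ Q))
    -- (ii)
    × (∀ (P Q R : Forcing) → Arboreal P → Arboreal Q → Arboreal R →
         P ⊏ Q → Q ⊏ R → P ⊏ R)
    × (∀ (P : Forcing) → Arboreal P → Σ Tree P → ¬ (P ⊏ P))
    -- (iii)
    × (∀ (W : WellOrder) (Ps : WellOrder.Idx W → Forcing) →
         (∀ α → Arboreal (Ps α)) → Increasing W Ps →
         ∀ μ → Σ (WellOrder.Idx W) (λ α → WellOrder._<_ W α μ) →
         (λ T → Σ (WellOrder.Idx W) λ α → WellOrder._<_ W α μ × Ps α T)
         ⊏ (λ T → Σ (WellOrder.Idx W) λ α → (μ ≡ α ⊎ WellOrder._<_ W μ α) × Ps α T))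
    -- (iv)
    × (∀ (W : WellOrder) (Ps : WellOrder.Idx W → Forcing) →
         (∀ α → Arboreal (Ps α)) → Increasing W Ps → (∀ α → Special (Ps α)) →
         Arboreal (λ T → Σ (WellOrder.Idx W) λ α → Ps α T)
         × Regular (λ T → Σ (WellOrder.Idx W) λ α → Ps α T)
         × (∀ γ → PreDenseIn (Ps γ) (λ T → Σ (WellOrder.Idx W) λ α → Ps α T)))
lemma5p2 em =
    (λ _ _ aℙ _ ℙ⊏ℚ → (λ _ _ → ⊏-meager aℙ ℙ⊏ℚ) , (λ _ → ⊏-disjoint ℙ⊏ℚ) , ⊏-openDense ℙ⊏ℚ)
  , (λ _ _ _ aℙ aℚ _ → ⊏-trans aℙ aℚ)
  , (λ _ _ (_ , T∈ℙ) ℙ⊏ℙ → ⊏-disjoint ℙ⊏ℙ T∈ℙ T∈ℙ)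
  , (λ W Ps _ inc _ (_ , α₀<μ) → Chain.⊏-⋃<-⋃≥ W Ps inc α₀<μ)
  , (λ W Ps arb inc special →
       Chain.⋃-arboreal W Ps arb , ⋃-regular W Ps inc special , ⋃-preDense W Ps arb inc)
  where open Classical em
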